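{- Let $\lambda X$ be a pure type system with specification $(\mathcal S,\mathcal A,\mathcal R)$. Suppose there are $n\in\mathbb N$ with $n>1$ and sorts $s_1,\dots,s_n\in\mathcal S$ such that $s_1=s_n\in\mathcal N$ and for each $1\le i<n$ there is $s'\in\mathcal I$ with $(s',s_i,s_{i+1})\in\mathcal R$. Then there are infinitely many pairwise $\beta$-distinct pseudoterms of the form $\Pi x{:}A.B$, none of which is obtained from another by substituting sorts for sorts, such that $\vdash(\Pi x{:}A.B):s_1$ is derivable in $\lambda X$.
   Context: Pure type systems (PTS): variables, constants $\mathcal C$, sorts $\mathcal S\subseteq\mathcal C$, axioms $\mathcal A$ ($c:s$), rules $\mathcal R\subseteq\mathcal S^3$; pseudoterms $\mathcal T::=V\mid\mathcal C\mid\Pi V{:}\mathcal T.\mathcal T\mid\lambda V{:}\mathcal T.\mathcal T\mid\mathcal T\mathcal T$; derivable judgements $\Gamma\vdash M:A$ generated by (axiom) $\vdash c:s$ for $(c:s)\in\mathcal A$; (start) $\Gamma\vdash A:s\Rightarrow\Gamma,x:A\vdash x:A$ ($x$ fresh); (weakening) $\Gamma\vdash M:B$, $\Gamma\vdash A:s\Rightarrow\Gamma,x:A\vdash M:B$ ($x$ fresh); (application) $\Gamma\vdash M:\Pi x{:}A.B$, $\Gamma\vdash N:A\Rightarrow\Gamma\vdash MN:B[x:=N]$; (abstraction) $\Gamma,x:A\vdash M:B$, $\Gamma\vdash(\Pi x{:}A.B):s\Rightarrow\Gamma\vdash(\lambda x{:}A.M):(\Pi x{:}A.B)$; (product) $\Gamma,x:A\vdash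 B:s_2$, $\Gamma\vdash A:s_1$, $(s_1,s_2,s_3)\in\mathcal R\Rightarrow\Gamma\vdash(\Pi x{:}A.B):s_3$; (conversion) $\Gamma\vdash M:A$, $\Gamma\vdash B:s$, $A=_\beta B\Rightarrow\Gamma\vdash M:B$. A sort $s$ is inhabited ($s\in\mathcal I$) if $\vdash A:s$ is derivable (empty context) for some pseudoterm $A$; it is normal form inhabited ($s\in\mathcal N$) if $\vdash A:s$ is derivable for some $A$ in $\beta$-normal form. -}

module Defs where

open import Data.Nat using (ℕ; zero; suc)
open import Data.Product using (Σ; ∃; _×_; _,_)
open import Relation.Nullary using (¬_)
open import Relation.Binary.PropositionalEquality using (_≡_)
open import Relation.Binary.Construct.Closure.Equivalence using (EqClosure)

record Spec : Set₁ where
  field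
    Const    : Set
    Sort     : Const → Set
    Ax       : Const → Const → Set
    ax-sort  : ∀ {c s} → Ax c s → Sort s
    Rule     : Const → Const → Const → Set
    rule-sorts : ∀ {s₁ s₂ s₃} → Rule s₁ s₂ s₃ → Sort s₁ × Sort s₂ × Sort s₃

module PTS (X : Spec) where
  open Spec X

  -- Pseudoterms, variables as de Bruijn indices (terms up to α-equivalence).
  data Term : Set where
    var   : ℕ → Term
    const : Const → Term
    Π     : Term → Term → Term     -- Π x:A.B  (B binds index 0)
    ƛ     : Term → Term → Term
    _·_   : Term → Term → Term

  infixl 7 _·_

  liftR : (ℕ → ℕ) → ℕ → ℕ
  liftR ρ zero    = zero
  liftR ρ (suc n) = suc (ρ n)

  rename : (ℕ → ℕ) → Term → Term
  rename ρ (var n)   = var (ρ n)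
  rename ρ (const c) = const c
  rename ρ (Π A B)   = Π (rename ρ A) (rename (liftR ρ) B)
  rename ρ (ƛ A M)   = ƛ (rename ρ A) (rename (liftR ρ) M)
  rename ρ (M · N)   = rename ρ M · rename ρ N

  wk : Term → Term
  wk = rename suc

  liftS : (ℕ → Term) → ℕ → Term
  liftS σ zero    = var zero
  liftS σ (suc n) = wk (σ n)

  subst : (ℕ → Term) → Term → Term
  subst σ (var n)   = σ n
  subst σ (const c) = const c
  subst σ (Π A B)   = Π (subst σ A) (subst (liftS σ) B)
  subst σ (ƛ A M)   = ƛ (subst σ A) (subst (liftS σ) M)
  subst σ (M · N)   = subst σ M · subst σ N

  single : Term → ℕ → Term
  single N zero    = N
  single N (suc n) = var n

  _[_] : Term → Term → Term
  B [ N ] = subst (single N) B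

  infix 4 _⟶β_ _=β_
  data _⟶β_ : Term → Term → Set where
    β    : ∀ {A M N} → (ƛ A M · N) ⟶β (M [ N ])
    Πˡ   : ∀ {A A' B} → A ⟶β A' → Π A B ⟶β Π A' B
    Πʳ   : ∀ {A B B'} → B ⟶β B' → Π A B ⟶β Π A B'
    ƛˡ   : ∀ {A A' M} → A ⟶β A' → ƛ A M ⟶β ƛ A' M
    ƛʳ   : ∀ {A M M'} → M ⟶β M' → ƛ A M ⟶β ƛ A M'
    ·ˡ   : ∀ {M M' N} → M ⟶β M' → M · N ⟶β M' · N
    ·ʳ   : ∀ {M N N'} → N ⟶β N' → M · N ⟶β M · N'

  _=β_ : Term → Term → Set
  _=β_ = EqClosure _⟶β_

  Normal : Term → Set
  Normal M = ∀ N → ¬ (M ⟶β N)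

  data Ctx : Set where
    ε   : Ctx
    _▸_ : Ctx → Term → Ctx

  infixl 5 _▸_
  infix 4 _⊢_∶_

  data _⊢_∶_ : Ctx → Term → Term → Set where
    axiom : ∀ {c s} → Ax c s → ε ⊢ const c ∶ const s
    start : ∀ {Γ A s} → Sort s → Γ ⊢ A ∶ const s → Γ ▸ A ⊢ var zero ∶ wk A
    weakening : ∀ {Γ M B A s} → Sort s → Γ ⊢ M ∶ B → Γ ⊢ A ∶ const s →
                Γ ▸ A ⊢ wk M ∶ wk B
    application : ∀ {Γ M N A B} → Γ ⊢ M ∶ Π A B → Γ ⊢ N ∶ A → Γ ⊢ M · N ∶ B [ N ]
    abstraction : ∀ {Γ A M B s} → Sort s → Γ ▸ A ⊢ M ∶ B → Γ ⊢ Π A B ∶ const s →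
                  Γ ⊢ ƛ A M ∶ Π A B
    product : ∀ {Γ A B s₁ s₂ s₃} → Γ ▸ A ⊢ B ∶ const s₂ → Γ ⊢ A ∶ const s₁ →
              Rule s₁ s₂ s₃ → Γ ⊢ Π A B ∶ const s₃
    conversion : ∀ {Γ M A B s} → Sort s → Γ ⊢ M ∶ A → Γ ⊢ B ∶ const s → A =β B →
                 Γ ⊢ M ∶ B

  -- inhabited sorts (I) and normal-form inhabited sorts (N)
  Inhabited : Const → Set
  Inhabited s = Sort s × ∃ λ A → ε ⊢ A ∶ const s

  NFInhabited : Const → Set
  NFInhabited s = Sort s × ∃ λ A → Normal A × (ε ⊢ A ∶ const s)

  IsSortMap : (Const → Const) → Set
  IsSortMap φ = (∀ c → Sort c → Sort (φ c)) × (∀ c → ¬ Sort c → φ c ≡ c)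

  sortSubst : (Const → Const) → Term → Term
  sortSubst φ (var n)   = var n
  sortSubst φ (const c) = const (φ c)
  sortSubst φ (Π A B)   = Π (sortSubst φ A) (sortSubst φ B)
  sortSubst φ (ƛ A M)   = ƛ (sortSubst φ A) (sortSubst φ M)
  sortSubst φ (M · N)   = sortSubst φ M · sortSubst φ N

-- Every rule (s', sᵢ, sᵢ₊₁) with s' inhabited by some C turns a type T : sᵢ into the
-- non-dependent product C → T : sᵢ₊₁. Going once around the cycle s₁, …, sₙ = s₁ thus
-- prefixes n − 1 products to a type of sort s₁; starting from a normal inhabitant of s₁
-- and going around i times yields types whose Π-spine ends in a normal term and has
-- length proportional to i. That length is preserved by parallel reduction, hence (by
-- Church–Rosser) by β-conversion, and trivially by substituting sorts for sorts, so it
-- separates the types in both senses.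
module Submission where

open import Defs
open import Data.Nat using (ℕ; zero; suc; pred; _≤_; _<_; _+_; _*_; z≤n; s≤s)
open import Data.Nat.Properties using (n<1+n; m<n⇒m<1+n; +-assoc; +-cancelʳ-≡; *-cancelʳ-≡)
open import Data.Product using (∃; _×_; _,_; proj₂)
open import Data.Empty using (⊥-elim)
open import Function using (_∘_)
open import Relation.Nullary using (¬_)
open import Relation.Binary.PropositionalEquality
  using (_≡_; _≢_; refl; sym; trans; cong; cong₂)
  renaming (subst to transport)
open import Relation.Binary.Construct.Closure.ReflexiveTransitive using (Star; ε; _◅_; _◅◅_; gmap)
open import Relation.Binary.Construct.Closure.Symmetric using (fwd; bwd)

module Theory (X : Spec) where
  open Spec X
  open PTS X

  liftR-∘ : ∀ {ρ ρ' ρ''} → (∀ x → ρ (ρ' x) ≡ ρ'' x) →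
            ∀ x → liftR ρ (liftR ρ' x) ≡ liftR ρ'' x
  liftR-∘ H zero    = refl
  liftR-∘ H (suc x) = cong suc (H x)

  rename-rename : ∀ {ρ ρ' ρ''} → (∀ x → ρ (ρ' x) ≡ ρ'' x) →
                  ∀ M → rename ρ (rename ρ' M) ≡ rename ρ'' M
  rename-rename H (var n)   = cong var (H n)
  rename-rename H (const c) = refl
  rename-rename H (Π A B)   = cong₂ Π (rename-rename H A) (rename-rename (liftR-∘ H) B)
  rename-rename H (ƛ A M)   = cong₂ ƛ (rename-rename H A) (rename-rename (liftR-∘ H) M)
  rename-rename H (M · N)   = cong₂ _·_ (rename-rename H M) (rename-rename H N)

  wk-rename : ∀ ρ M → wk (rename ρ M) ≡ rename (liftR ρ) (wk M)
  wk-rename ρ M = trans (rename-rename (λ _ → refl) M) (sym (rename-rename (λ _ → refl) M))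

  liftS-liftR : ∀ {σ ρ τ} → (∀ x → σ (ρ x) ≡ τ x) →
                ∀ x → liftS σ (liftR ρ x) ≡ liftS τ x
  liftS-liftR H zero    = refl
  liftS-liftR H (suc x) = cong wk (H x)

  subst-rename : ∀ {σ ρ τ} → (∀ x → σ (ρ x) ≡ τ x) →
                 ∀ M → subst σ (rename ρ M) ≡ subst τ M
  subst-rename H (var n)   = H n
  subst-rename H (const c) = refl
  subst-rename H (Π A B)   = cong₂ Π (subst-rename H A) (subst-rename (liftS-liftR H) B)
  subst-rename H (ƛ A M)   = cong₂ ƛ (subst-rename H A) (subst-rename (liftS-liftR H) M)
  subst-rename H (M · N)   = cong₂ _·_ (subst-rename H M) (subst-rename H N)

  liftR-liftS : ∀ {ρ σ τ} → (∀ x → rename ρ (σ x) ≡ τ x) →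
                ∀ x → rename (liftR ρ) (liftS σ x) ≡ liftS τ x
  liftR-liftS H zero             = refl
  liftR-liftS {ρ} {σ} H (suc x) = trans (sym (wk-rename ρ (σ x))) (cong wk (H x))

  rename-subst : ∀ {ρ σ τ} → (∀ x → rename ρ (σ x) ≡ τ x) →
                 ∀ M → rename ρ (subst σ M) ≡ subst τ M
  rename-subst H (var n)   = H n
  rename-subst H (const c) = refl
  rename-subst H (Π A B)   = cong₂ Π (rename-subst H A) (rename-subst (liftR-liftS H) B)
  rename-subst H (ƛ A M)   = cong₂ ƛ (rename-subst H A) (rename-subst (liftR-liftS H) M)
  rename-subst H (M · N)   = cong₂ _·_ (rename-subst H M) (rename-subst H N)

  wk-subst : ∀ σ M → wk (subst σ M) ≡ subst (liftS σ) (wk M)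
  wk-subst σ M = trans (rename-subst (λ _ → refl) M) (sym (subst-rename (λ _ → refl) M))

  liftS-∘ : ∀ {σ τ υ} → (∀ x → subst σ (τ x) ≡ υ x) →
            ∀ x → subst (liftS σ) (liftS τ x) ≡ liftS υ x
  liftS-∘ H zero             = refl
  liftS-∘ {σ} {τ} H (suc x) = trans (sym (wk-subst σ (τ x))) (cong wk (H x))

  subst-subst : ∀ {σ τ υ} → (∀ x → subst σ (τ x) ≡ υ x) →
                ∀ M → subst σ (subst τ M) ≡ subst υ M
  subst-subst H (var n)   = H n
  subst-subst H (const c) = refl
  subst-subst H (Π A B)   = cong₂ Π (subst-subst H A) (subst-subst (liftS-∘ H) B)
  subst-subst H (ƛ A M)   = cong₂ ƛ (subst-subst H A) (subst-subst (liftS-∘ H) M)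
  subst-subst H (M · N)   = cong₂ _·_ (subst-subst H M) (subst-subst H N)

  liftS-var : ∀ {σ} → (∀ x → σ x ≡ var x) → ∀ x → liftS σ x ≡ var x
  liftS-var H zero    = refl
  liftS-var H (suc x) = cong wk (H x)

  subst-var : ∀ {σ} → (∀ x → σ x ≡ var x) → ∀ M → subst σ M ≡ M
  subst-var H (var n)   = H n
  subst-var H (const c) = refl
  subst-var H (Π A B)   = cong₂ Π (subst-var H A) (subst-var (liftS-var H) B)
  subst-var H (ƛ A M)   = cong₂ ƛ (subst-var H A) (subst-var (liftS-var H) M)
  subst-var H (M · N)   = cong₂ _·_ (subst-var H M) (subst-var H N)

  subst-single-wk : ∀ N M → subst (single N) (wk M) ≡ M
  subst-single-wk N M = trans (subst-rename (λ _ → refl) M) (subst-var (λ _ → refl) M)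

  rename-[] : ∀ ρ M N → rename ρ (M [ N ]) ≡ rename (liftR ρ) M [ rename ρ N ]
  rename-[] ρ M N = trans (rename-subst (λ _ → refl) M) (sym (subst-rename single-liftR M))
    where
      single-liftR : ∀ x → single (rename ρ N) (liftR ρ x) ≡ rename ρ (single N x)
      single-liftR zero    = refl
      single-liftR (suc x) = refl

  subst-[] : ∀ σ M N → subst σ (M [ N ]) ≡ subst (liftS σ) M [ subst σ N ]
  subst-[] σ M N = trans (subst-subst (λ _ → refl) M) (sym (subst-subst single-liftS M))
    where
      single-liftS : ∀ x → subst (single (subst σ N)) (liftS σ x) ≡ subst σ (single N x)
      single-liftS zero    = refl
      single-liftS (suc x) = subst-single-wk (subst σ N) (σ x)

  -- Parallel reduction and the Church–Rosser theorem

  infix 4 _⇛_ _⇛*_ _⟶β*_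

  data _⇛_ : Term → Term → Set where
    var   : ∀ {n} → var n ⇛ var n
    const : ∀ {c} → const c ⇛ const c
    Π     : ∀ {A A' B B'} → A ⇛ A' → B ⇛ B' → Π A B ⇛ Π A' B'
    ƛ     : ∀ {A A' M M'} → A ⇛ A' → M ⇛ M' → ƛ A M ⇛ ƛ A' M'
    _·_   : ∀ {M M' N N'} → M ⇛ M' → N ⇛ N' → M · N ⇛ M' · N'
    β     : ∀ {A M M' N N'} → M ⇛ M' → N ⇛ N' → ƛ A M · N ⇛ M' [ N' ]

  _⇛*_ : Term → Term → Set
  _⇛*_ = Star _⇛_

  _⟶β*_ : Term → Term → Set
  _⟶β*_ = Star _⟶β_

  ⇛-refl : ∀ M → M ⇛ M
  ⇛-refl (var n)   = var
  ⇛-refl (const c) = const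
  ⇛-refl (Π A B)   = Π (⇛-refl A) (⇛-refl B)
  ⇛-refl (ƛ A M)   = ƛ (⇛-refl A) (⇛-refl M)
  ⇛-refl (M · N)   = ⇛-refl M · ⇛-refl N

  ⟶β⇒⇛ : ∀ {M N} → M ⟶β N → M ⇛ N
  ⟶β⇒⇛ (β {M = M} {N}) = β (⇛-refl M) (⇛-refl N)
  ⟶β⇒⇛ (Πˡ {B = B} r)  = Π (⟶β⇒⇛ r) (⇛-refl B)
  ⟶β⇒⇛ (Πʳ {A = A} r)  = Π (⇛-refl A) (⟶β⇒⇛ r)
  ⟶β⇒⇛ (ƛˡ {M = M} r)  = ƛ (⟶β⇒⇛ r) (⇛-refl M)
  ⟶β⇒⇛ (ƛʳ {A = A} r)  = ƛ (⇛-refl A) (⟶β⇒⇛ r)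
  ⟶β⇒⇛ (·ˡ {N = N} r)  = ⟶β⇒⇛ r · ⇛-refl N
  ⟶β⇒⇛ (·ʳ {M = M} r)  = ⇛-refl M · ⟶β⇒⇛ r

  ⇛⇒⟶β* : ∀ {M N} → M ⇛ N → M ⟶β* N
  ⇛⇒⟶β* var   = ε
  ⇛⇒⟶β* const = ε
  ⇛⇒⟶β* (Π {_} {A'} {B} a b) =
    gmap (λ A → Π A B) Πˡ (⇛⇒⟶β* a) ◅◅ gmap (Π A') Πʳ (⇛⇒⟶β* b)
  ⇛⇒⟶β* (ƛ {_} {A'} {M} a m) =
    gmap (λ A → ƛ A M) ƛˡ (⇛⇒⟶β* a) ◅◅ gmap (ƛ A') ƛʳ (⇛⇒⟶β* m)
  ⇛⇒⟶β* (_·_ {_} {M'} {N} m n) =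
    gmap (_· N) ·ˡ (⇛⇒⟶β* m) ◅◅ gmap (M' ·_) ·ʳ (⇛⇒⟶β* n)
  ⇛⇒⟶β* (β {A} {_} {M'} {N} m n) =
    gmap (λ M → ƛ A M · N) (·ˡ ∘ ƛʳ) (⇛⇒⟶β* m) ◅◅ gmap (ƛ A M' ·_) ·ʳ (⇛⇒⟶β* n) ◅◅ β ◅ ε

  ⇛-rename : ∀ ρ {M M'} → M ⇛ M' → rename ρ M ⇛ rename ρ M'
  ⇛-rename ρ var       = var
  ⇛-rename ρ const     = const
  ⇛-rename ρ (Π a b)   = Π (⇛-rename ρ a) (⇛-rename (liftR ρ) b)
  ⇛-rename ρ (ƛ a m)   = ƛ (⇛-rename ρ a) (⇛-rename (liftR ρ) m)
  ⇛-rename ρ (m · n)   = ⇛-rename ρ m · ⇛-rename ρ n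
  ⇛-rename ρ (β {M' = M'} {N' = N'} m n) =
    transport (_ ⇛_) (sym (rename-[] ρ M' N')) (β (⇛-rename (liftR ρ) m) (⇛-rename ρ n))

  ⇛-liftS : ∀ {σ σ'} → (∀ x → σ x ⇛ σ' x) → ∀ x → liftS σ x ⇛ liftS σ' x
  ⇛-liftS H zero    = var
  ⇛-liftS H (suc x) = ⇛-rename suc (H x)

  ⇛-subst : ∀ {σ σ'} → (∀ x → σ x ⇛ σ' x) → ∀ {M M'} → M ⇛ M' → subst σ M ⇛ subst σ' M'
  ⇛-subst H var     = H _
  ⇛-subst H const   = const
  ⇛-subst H (Π a b) = Π (⇛-subst H a) (⇛-subst (⇛-liftS H) b)
  ⇛-subst H (ƛ a m) = ƛ (⇛-subst H a) (⇛-subst (⇛-liftS H) m)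
  ⇛-subst H (m · n) = ⇛-subst H m · ⇛-subst H n
  ⇛-subst {σ' = σ'} H (β {M' = M'} {N' = N'} m n) =
    transport (_ ⇛_) (sym (subst-[] σ' M' N')) (β (⇛-subst (⇛-liftS H) m) (⇛-subst H n))

  ⇛-[] : ∀ {M M' N N'} → M ⇛ M' → N ⇛ N' → M [ N ] ⇛ M' [ N' ]
  ⇛-[] {N = N} {N'} m n = ⇛-subst single-⇛ m
    where
      single-⇛ : ∀ x → single N x ⇛ single N' x
      single-⇛ zero    = n
      single-⇛ (suc x) = var

  -- Takahashi's complete development.
  develop : Term → Term
  develop (var n)       = var n
  develop (const c)     = const c
  develop (Π A B)       = Π (develop A) (develop B)
  develop (ƛ A M)       = ƛ (develop A) (develop M)
  develop (ƛ A M · N)   = develop M [ develop N ]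
  develop (M · N)       = develop M · develop N

  ⇛-develop : ∀ {M N} → M ⇛ N → N ⇛ develop M
  ⇛-develop var             = var
  ⇛-develop const           = const
  ⇛-develop (Π a b)         = Π (⇛-develop a) (⇛-develop b)
  ⇛-develop (ƛ a m)         = ƛ (⇛-develop a) (⇛-develop m)
  ⇛-develop (ƛ a m · n)     = β (⇛-develop m) (⇛-develop n)
  -- develop (M · N) only unfolds once M is known not to be an abstraction.
  ⇛-develop (m@var · n)     = ⇛-develop m · ⇛-develop n
  ⇛-develop (m@const · n)   = ⇛-develop m · ⇛-develop n
  ⇛-develop (m@(Π _ _) · n) = ⇛-develop m · ⇛-develop n
  ⇛-develop (m@(_ · _) · n) = ⇛-develop m · ⇛-develop n
  ⇛-develop (m@(β _ _) · n) = ⇛-develop m · ⇛-develop n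
  ⇛-develop (β m n)         = ⇛-[] (⇛-develop m) (⇛-develop n)

  ⇛-strip : ∀ {M N M'} → M ⇛ N → M ⇛* M' → ∃ λ Z → N ⇛* Z × M' ⇛ Z
  ⇛-strip {N = N} r ε = N , ε , r
  ⇛-strip r (r' ◅ rs) with ⇛-strip (⇛-develop r') rs
  ... | Z , N⇛*Z , M'⇛Z = Z , ⇛-develop r ◅ N⇛*Z , M'⇛Z

  ⇛*-confluent : ∀ {M N M'} → M ⇛* N → M ⇛* M' → ∃ λ Z → N ⇛* Z × M' ⇛* Z
  ⇛*-confluent {M' = M'} ε rs' = M' , rs' , ε
  ⇛*-confluent (r ◅ rs) rs' with ⇛-strip r rs'
  ... | Z₁ , Z₁' , M'⇛Z₁ with ⇛*-confluent rs Z₁'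
  ...   | Z , N⇛*Z , Z₁⇛*Z = Z , N⇛*Z , M'⇛Z₁ ◅ Z₁⇛*Z

  church-rosser : ∀ {M N} → M =β N → ∃ λ Z → M ⇛* Z × N ⇛* Z
  church-rosser {M} ε = M , ε , ε
  church-rosser (fwd r ◅ c) with church-rosser c
  ... | Z , M⇛*Z , N⇛*Z = Z , ⟶β⇒⇛ r ◅ M⇛*Z , N⇛*Z
  church-rosser (bwd r ◅ c) with church-rosser c
  ... | Z , M⇛*Z , N⇛*Z with ⇛*-confluent (⟶β⇒⇛ r ◅ ε) M⇛*Z
  ...   | W , M'⇛*W , Z⇛*W = W , M'⇛*W , N⇛*Z ◅◅ Z⇛*W

  spineDepth : Term → ℕ
  spineDepth (Π A B) = suc (spineDepth B)
  spineDepth _       = 0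

  data NormalSpine : Term → Set where
    normal : ∀ {M} → Normal M → NormalSpine M
    Π      : ∀ {A B} → NormalSpine B → NormalSpine (Π A B)

  normal-⇛ : ∀ {M N} → Normal M → M ⇛ N → M ≡ N
  normal-⇛ nf r with ⇛⇒⟶β* r
  ... | ε      = refl
  ... | r' ◅ _ = ⊥-elim (nf _ r')

  NormalSpine-⇛ : ∀ {M N} → NormalSpine M → M ⇛ N → NormalSpine N × spineDepth N ≡ spineDepth M
  NormalSpine-⇛ (normal nf) r with normal-⇛ nf r
  ... | refl = normal nf , refl
  NormalSpine-⇛ (Π sp) (Π _ b) with NormalSpine-⇛ sp b
  ... | sp' , eq = Π sp' , cong suc eq

  spineDepth-⇛* : ∀ {M N} → NormalSpine M → M ⇛* N → spineDepth N ≡ spineDepth M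
  spineDepth-⇛* sp ε = refl
  spineDepth-⇛* sp (r ◅ rs) with NormalSpine-⇛ sp r
  ... | sp' , eq = trans (spineDepth-⇛* sp' rs) eq

  spineDepth-=β : ∀ {M N} → NormalSpine M → NormalSpine N → M =β N → spineDepth M ≡ spineDepth N
  spineDepth-=β spM spN c with church-rosser c
  ... | Z , M⇛*Z , N⇛*Z = trans (sym (spineDepth-⇛* spM M⇛*Z)) (spineDepth-⇛* spN N⇛*Z)

  spineDepth-sortSubst : ∀ φ M → spineDepth (sortSubst φ M) ≡ spineDepth M
  spineDepth-sortSubst φ (var n)   = refl
  spineDepth-sortSubst φ (const c) = refl
  spineDepth-sortSubst φ (Π A B)   = cong suc (spineDepth-sortSubst φ B)
  spineDepth-sortSubst φ (ƛ A M)   = refl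
  spineDepth-sortSubst φ (M · N)   = refl

  spineDepth-rename : ∀ ρ M → spineDepth (rename ρ M) ≡ spineDepth M
  spineDepth-rename ρ (var n)   = refl
  spineDepth-rename ρ (const c) = refl
  spineDepth-rename ρ (Π A B)   = cong suc (spineDepth-rename (liftR ρ) B)
  spineDepth-rename ρ (ƛ A M)   = refl
  spineDepth-rename ρ (M · N)   = refl

  spineDepth≡suc⇒Π : ∀ M {d} → spineDepth M ≡ suc d → ∃ λ A → ∃ λ B → M ≡ Π A B
  spineDepth≡suc⇒Π (Π A B) _ = A , B , refl

  rename-⟶β-reflect : ∀ ρ M {N} → rename ρ M ⟶β N → ∃ λ M' → M ⟶β M'
  rename-⟶β-reflect ρ (Π A B) (Πˡ r)  = _ , Πˡ (proj₂ (rename-⟶β-reflect ρ A r))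
  rename-⟶β-reflect ρ (Π A B) (Πʳ r)  = _ , Πʳ (proj₂ (rename-⟶β-reflect (liftR ρ) B r))
  rename-⟶β-reflect ρ (ƛ A M) (ƛˡ r)  = _ , ƛˡ (proj₂ (rename-⟶β-reflect ρ A r))
  rename-⟶β-reflect ρ (ƛ A M) (ƛʳ r)  = _ , ƛʳ (proj₂ (rename-⟶β-reflect (liftR ρ) M r))
  rename-⟶β-reflect ρ (ƛ A M · N) β   = _ , β
  rename-⟶β-reflect ρ (M · N) (·ˡ r)  = _ , ·ˡ (proj₂ (rename-⟶β-reflect ρ M r))
  rename-⟶β-reflect ρ (M · N) (·ʳ r)  = _ , ·ʳ (proj₂ (rename-⟶β-reflect ρ N r))

  Normal-rename : ∀ ρ {M} → Normal M → Normal (rename ρ M)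
  Normal-rename ρ {M} nf N r = nf _ (proj₂ (rename-⟶β-reflect ρ M r))

  NormalSpine-rename : ∀ ρ {M} → NormalSpine M → NormalSpine (rename ρ M)
  NormalSpine-rename ρ (normal nf) = normal (Normal-rename ρ nf)
  NormalSpine-rename ρ (Π sp)      = Π (NormalSpine-rename (liftR ρ) sp)

  infixr 6 _⇒_

  _⇒_ : Term → Term → Term
  C ⇒ T = Π C (wk T)

  ⊢⇒ : ∀ {Γ C T s₁ s₂ s₃} → Sort s₁ → Γ ⊢ C ∶ const s₁ → Γ ⊢ T ∶ const s₂ → Rule s₁ s₂ s₃ →
       Γ ⊢ C ⇒ T ∶ const s₃
  ⊢⇒ srt ⊢C ⊢T r = product (weakening srt ⊢T ⊢C) ⊢C r

  NormalSpine-⇒ : ∀ C {T} → NormalSpine T → NormalSpine (C ⇒ T)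
  NormalSpine-⇒ C sp = Π (NormalSpine-rename suc sp)

  spineDepth-⇒ : ∀ C T → spineDepth (C ⇒ T) ≡ suc (spineDepth T)
  spineDepth-⇒ C T = cong suc (spineDepth-rename suc T)

  LadderStep : (ℕ → Const) → ℕ → Set
  LadderStep t i = ∃ λ s' → Inhabited s' × Rule s' (t i) (t (suc i))

  record TypeOfDepth (s : Const) (d : ℕ) : Set where
    constructor ⟨_,_,_,_⟩
    field
      type        : Term
      ⊢type       : ε ⊢ type ∶ const s
      normalSpine : NormalSpine type
      depth       : spineDepth type ≡ d

  climb : ∀ t m → (∀ i → i < m → LadderStep t i) →
          ∀ {d} → TypeOfDepth (t 0) d → TypeOfDepth (t m) (m + d)
  climb t zero    steps T = T
  climb t (suc m) steps T with climb t m (λ i i<m → steps i (m<n⇒m<1+n i<m)) T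
                             | steps m (n<1+n m)
  ... | ⟨ T' , ⊢T' , spT' , depth ⟩ | s' , (srt , C , ⊢C) , r =
    ⟨ C ⇒ T' , ⊢⇒ srt ⊢C ⊢T' r , NormalSpine-⇒ C spT' , trans (spineDepth-⇒ C T') (cong suc depth) ⟩

  around-cycle : ∀ t m → (∀ i → i < m → LadderStep t i) → t m ≡ t 0 →
                 ∀ {d} → TypeOfDepth (t 0) d → ∀ r → TypeOfDepth (t 0) (r * m + d)
  around-cycle t m steps closed T zero = T
  around-cycle t m steps closed {d} T (suc r)
    with climb t m steps (around-cycle t m steps closed T r)
  ... | ⟨ T' , ⊢T' , spT' , depth ⟩ =
    ⟨ T' , transport (λ s → ε ⊢ T' ∶ const s) closed ⊢T' , spT' ,
      trans depth (sym (+-assoc m (r * m) d)) ⟩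

lemma12 : (X : Spec) → let open PTS X in
    (n : ℕ) → 1 < n → (s : ℕ → Spec.Const X) →
    (∀ i → 1 ≤ i → i ≤ n → Spec.Sort X (s i)) →
    s 1 ≡ s n → NFInhabited (s 1) →
    (∀ i → 1 ≤ i → i < n → ∃ λ s' → Inhabited s' × Spec.Rule X s' (s i) (s (suc i))) →
    ∃ λ (f : ℕ → Term) →
      (∀ i → ∃ λ A → ∃ λ B → f i ≡ Π A B) ×
      (∀ i → ε ⊢ f i ∶ const (s 1)) ×
      (∀ i j → i ≢ j → ¬ (f i =β f j)) ×
      (∀ i j → i ≢ j → ∀ φ → IsSortMap φ → sortSubst φ (f i) ≢ f j)
lemma12 X (suc (suc k)) (s≤s (s≤s z≤n)) s _ s₁≡sₙ (_ , A , nfA , ⊢A) steps =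
  f , (λ i → spineDepth≡suc⇒Π (f i) (depth (tower i))) , (⊢type ∘ tower) ,
  separated-=β , separated-sortSubst
  where
    open PTS X
    open Theory X
    open TypeOfDepth

    tower : ∀ i → TypeOfDepth (s 1) (suc i * suc k + spineDepth A)
    tower i = around-cycle (s ∘ suc) (suc k) (λ i i<n → steps (suc i) (s≤s z≤n) (s≤s i<n))
                (sym s₁≡sₙ) ⟨ A , ⊢A , normal nfA , refl ⟩ (suc i)

    f : ℕ → Term
    f = type ∘ tower

    depth-injective : ∀ i j → spineDepth (f i) ≡ spineDepth (f j) → i ≡ j
    depth-injective i j eq = cong pred (*-cancelʳ-≡ (suc i) (suc j) (suc k)
      (+-cancelʳ-≡ (spineDepth A) _ _ (trans (sym (depth (tower i))) (trans eq (depth (tower j))))))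

    separated-=β : ∀ i j → i ≢ j → ¬ (f i =β f j)
    separated-=β i j i≢j c =
      i≢j (depth-injective i j (spineDepth-=β (normalSpine (tower i)) (normalSpine (tower j)) c))

    separated-sortSubst : ∀ i j → i ≢ j → ∀ φ → IsSortMap φ → sortSubst φ (f i) ≢ f j
    separated-sortSubst i j i≢j φ _ eq = i≢j (depth-injective i j
      (trans (sym (spineDepth-sortSubst φ (f i))) (cong spineDepth eq)))
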